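{- Let $H$ be an instance as described in the context, and run the following algorithm. For each tuple $\langle c^1,\ldots,c^{|\mathcal{A}|}\rangle$ where, for the agents $a_1,\ldots,a_{|\mathcal{A}|}$, each $c^i$ is one of the costs of programs on $a_i$'s preference list: let $H'$ be the set of edges $(a_i,p)\in E$ with $c(p)=c^i$; then repeatedly (as long as every agent has at least one edge in $H'$ and deletions keep occurring), for every agent $a_i$ let $p$ be $a_i$'s most-preferred program with $(a_i,p)\in H'$, and for every program $p'$ with $p'>_{a_i}p$ and every agent $a$ with $a_i>_{p'}a$, delete $(a,p')$ from $H'$. If afterwards no agent is isolated in $H'$, let $M'$ match every agent to its most-preferred program in $H'$, and keep $M'$ if its total cost $\sum_{p}|M'(p)|c(p)$ is at most the best cost found so far. Output the kept matching $M$. Then the matching $M$ output by this algorithm is stable.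
   Context: An instance consists of a bipartite graph $(\mathcal{A}\cup\mathcal{B},E)$, agents $\mathcal{A}$, programs $\mathcal{B}$, $(a,p)\in E$ iff mutually acceptable. Each agent and each program ranks its neighbours in a strict order ($y>_x z$: $x$ prefers $y$ to $z$). Each program $p$ has a non-negative integer cost $c(p)$; programs have no quotas. A matching $M\subseteq E$ assigns each agent to at most one program (a program may receive any number of agents); $M(a)$, $M(p)$ denote partners. An agent prefers any acceptable program to being unmatched. A pair $(a,p)\in E\setminus M$ blocks $M$ if $p>_a M(a)$ and there is $a'\in M(p)$ with $a>_p a'$; $M$ is stable if no pair blocks it. -}

module Defs where

open import Data.Nat using (ℕ; zero; suc; _+_; _*_; _≤ᵇ_; _≡ᵇ_)
open import Data.Fin using (Fin; _<_)
import Data.Fin as F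
open import Data.Bool using (Bool; true; false; _∧_; _∨_; not; if_then_else_)
open import Data.Maybe using (Maybe; just; nothing)
open import Data.List using (List; []; _∷_; length; lookup; allFin; map; concatMap; foldl)
open import Data.Bool.ListAction using (and)
open import Data.Nat.ListAction using (sum)
open import Data.List.Membership.Propositional using (_∈_)
open import Data.List.Relation.Unary.Unique.Propositional using (Unique)
open import Data.Vec using (Vec)
import Data.Vec as V
open import Data.Product using (Σ; _×_; _,_; ∃)
open import Data.Unit using (⊤)
open import Relation.Nullary using (¬_)
open import Relation.Nullary.Decidable using (⌊_⌋)
open import Relation.Binary.PropositionalEquality using (_≡_; _≢_)

-- Instances: agents Fin n, programs Fin m.
-- Preference lists: earlier in the list = more preferred (strict order).
-- (a , p) ∈ E  iff  p ∈ prefA a  iff  a ∈ prefP p.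

record Instance : Set where
  field
    n m        : ℕ
    prefA      : Fin n → List (Fin m)
    prefP      : Fin m → List (Fin n)
    uniqueA    : ∀ a → Unique (prefA a)
    uniqueP    : ∀ p → Unique (prefP p)
    consistent₁ : ∀ a p → p ∈ prefA a → a ∈ prefP p
    consistent₂ : ∀ a p → a ∈ prefP p → p ∈ prefA a
    cost       : Fin m → ℕ

Ranks : ∀ {k} → List (Fin k) → Fin k → Fin k → Set
Ranks xs x y = Σ (Fin (length xs)) λ i → Σ (Fin (length xs)) λ j →
  (i < j) × (lookup xs i ≡ x) × (lookup xs j ≡ y)

module _ (I : Instance) where
  open Instance I

  -- a matching: each agent assigned to at most one program (programs: no quota)
  Assignment : Set
  Assignment = Fin n → Maybe (Fin m)

  IsMatching : Assignment → Set
  IsMatching M = ∀ a p → M a ≡ just p → p ∈ prefA a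

  AgentPrefers : Fin n → Fin m → Maybe (Fin m) → Set
  AgentPrefers a p nothing  = ⊤
  AgentPrefers a p (just q) = Ranks (prefA a) p q

  Blocks : Assignment → Fin n → Fin m → Set
  Blocks M a p =
    (p ∈ prefA a) × (M a ≢ just p) × AgentPrefers a p (M a) ×
    (∃ λ a' → (M a' ≡ just p) × Ranks (prefP p) a a')

  Stable : Assignment → Set
  Stable M = ∀ a p → ¬ Blocks M a p

_==_ : ∀ {k} → Fin k → Fin k → Bool
x == y = ⌊ x F.≟ y ⌋

elemᵇ : ∀ {k} → Fin k → List (Fin k) → Bool
elemᵇ x []       = false
elemᵇ x (z ∷ zs) = (x == z) ∨ elemᵇ x zs

beforeᵇ : ∀ {k} → List (Fin k) → Fin k → Fin k → Bool
beforeᵇ []       x y = false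
beforeᵇ (z ∷ zs) x y =
  if z == y then false else (if z == x then elemᵇ y zs else beforeᵇ zs x y)

firstWith : ∀ {A : Set} → (A → Bool) → List A → Maybe A
firstWith f []       = nothing
firstWith f (x ∷ xs) = if f x then just x else firstWith f xs

isJust : ∀ {A : Set} → Maybe A → Bool
isJust (just _) = true
isJust nothing  = false

tuples : (k : ℕ) → (Fin k → List ℕ) → List (Vec ℕ k)
tuples zero    L = V.[] ∷ []
tuples (suc k) L =
  concatMap (λ c → map (λ t → c V.∷ t) (tuples k (λ i → L (F.suc i)))) (L F.zero)

module Algorithm (I : Instance) where
  open Instance I

  Graph : Set
  Graph = Fin n → Fin m → Bool

  top : Graph → Fin n → Maybe (Fin m)
  top H a = firstWith (H a) (prefA a)

  nonIsolated : Graph → Bool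
  nonIsolated H = and (map (λ a → isJust (top H a)) (allFin n))

  sameGraph : Graph → Graph → Bool
  sameGraph H H' =
    and (map (λ a → and (map (λ p → ⌊ Data.Bool._≟_ (H a p) (H' a p) ⌋) (allFin m))) (allFin n))

  processAgent : Graph → Fin n → Graph
  processAgent H ai with top H ai
  ... | nothing = H
  ... | just p  = λ a p' → H a p' ∧ not (beforeᵇ (prefA ai) p' p ∧ beforeᵇ (prefP p') ai a)

  round : Graph → Graph
  round H = foldl processAgent H (allFin n)

  -- repeat rounds while every agent has an edge and deletions keep occurring
  -- (fuel n*m+1 suffices: every productive round deletes at least one edge)
  loop : ℕ → Graph → Graph
  loop zero    H = H
  loop (suc f) H =
    if nonIsolated H
    then (let H' = round H in if sameGraph H H' then H' else loop f H')
    else H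

  initial : Vec ℕ n → Graph
  initial t a p = elemᵇ p (prefA a) ∧ (cost p ≡ᵇ V.lookup t a)

  reduced : Vec ℕ n → Graph
  reduced t = loop (suc (n * m)) (initial t)

  totalCost : Assignment I → ℕ
  totalCost M =
    sum (map (λ p → length (Data.List.filterᵇ (λ a → matchesP (M a) p) (allFin n)) * cost p) (allFin m))
    where
    matchesP : Maybe (Fin m) → Fin m → Bool
    matchesP nothing  p = false
    matchesP (just q) p = q == p

  step : Maybe (Assignment I × ℕ) → Vec ℕ n → Maybe (Assignment I × ℕ)
  step best t with nonIsolated (reduced t)
  ... | false = best
  ... | true with best
  ...   | nothing = just (top (reduced t) , totalCost (top (reduced t)))
  ...   | just (Mb , cb) =
          if totalCost (top (reduced t)) ≤ᵇ cb
          then just (top (reduced t) , totalCost (top (reduced t)))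
          else just (Mb , cb)

  costTuples : List (Vec ℕ n)
  costTuples = tuples n (λ a → map cost (prefA a))

  output : Maybe (Assignment I)
  output with foldl step nothing costTuples
  ... | nothing      = nothing
  ... | just (M , _) = just M

-- The output is top R for a cost tuple whose reduced graph R has no isolated agent. The fuel
-- of the reduction loop never runs out, since every round that changes the graph deletes an
-- edge, so R is returned by a round that deleted nothing: no edge (a', p) of R is dominated,
-- i.e. has p >_a top R a and a >_p a' for some agent a. A blocking pair (a, p) with
-- a' ∈ M(p) and a >_p a' would give exactly such an edge, as (a', p) ∈ R is the top edge of a'.

module Submission where

open import Defs
open import Data.Nat using (ℕ; suc; _*_; _≤_; _<_; z≤n; s≤s; _≤ᵇ_)
open import Data.Nat.Properties
  using (≤-refl; <-≤-trans; ≤-pred; +-mono-≤; +-mono-<-≤; +-mono-≤-<; *-identityʳ; module ≤-Reasoning)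
open import Data.Nat.ListAction using (sum)
open import Data.Fin using (Fin)
import Data.Fin as F
open import Data.Bool using (Bool; true; false; _∧_; not)
import Data.Bool as B
open import Data.Bool.Properties using (∧-conicalˡ; ∧-conicalʳ; not-injective; T-≡; ⇔→≡)
open import Data.Bool.ListAction using (all)
open import Data.Maybe using (Maybe; just; nothing)
open import Data.List using (List; []; _∷_; length; lookup; allFin; map; foldl)
open import Data.List.Properties using (length-tabulate)
open import Data.List.Membership.Propositional using (_∈_)
open import Data.List.Membership.Propositional.Properties using (∈-allFin; ∈-lookup)
open import Data.List.Relation.Unary.Any using (here; there)
import Data.List.Relation.Unary.All as All
open import Data.List.Relation.Unary.All.Properties using (all⁺)
open import Data.List.Relation.Unary.AllPairs using (_∷_)
open import Data.List.Relation.Unary.Unique.Propositional using (Unique)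
open import Data.Product using (∃; _×_; _,_)
open import Data.Unit using (⊤; tt)
open import Function.Bundles using (mk⇔; Equivalence)
open import Relation.Nullary using (yes; no; contradiction)
open import Relation.Nullary.Decidable using (⌊_⌋)
open import Relation.Binary.PropositionalEquality using (_≡_; _≢_; refl; sym; trans; cong; cong₂)

==-refl : ∀ {k} (x : Fin k) → (x == x) ≡ true
==-refl x with x F.≟ x
... | yes _  = refl
... | no x≢x = contradiction refl x≢x

==-≢ : ∀ {k} {x y : Fin k} → x ≢ y → (x == y) ≡ false
==-≢ {x = x} {y} x≢y with x F.≟ y
... | yes x≡y = contradiction x≡y x≢y
... | no _    = refl

elemᵇ-complete : ∀ {k} {y : Fin k} {xs} → y ∈ xs → elemᵇ y xs ≡ true
elemᵇ-complete {y = y} (here refl) rewrite ==-refl y = refl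
elemᵇ-complete {y = y} {z ∷ _} (there y∈zs) with y == z
... | true  = refl
... | false = elemᵇ-complete y∈zs

-- Uniqueness is what guarantees that the later element y is not met first.
Ranks⇒beforeᵇ : ∀ {k} {xs : List (Fin k)} {x y} → Unique xs → Ranks xs x y → beforeᵇ xs x y ≡ true
Ranks⇒beforeᵇ {xs = z ∷ zs} (z∉zs ∷ _) (F.zero , F.suc j , _ , refl , refl)
  rewrite ==-≢ (All.lookup z∉zs (∈-lookup j)) | ==-refl z
  = elemᵇ-complete {xs = zs} (∈-lookup j)
Ranks⇒beforeᵇ {xs = z ∷ zs} (z∉zs ∷ u) (F.suc i , F.suc j , s≤s i<j , refl , refl)
  rewrite ==-≢ (All.lookup z∉zs (∈-lookup j)) | ==-≢ (All.lookup z∉zs (∈-lookup i))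
  = Ranks⇒beforeᵇ u (i , j , i<j , refl , refl)

firstWith-satisfies : ∀ {A : Set} (f : A → Bool) xs {y} → firstWith f xs ≡ just y → f y ≡ true
firstWith-satisfies f (x ∷ xs) eq with f x in fx
firstWith-satisfies f (x ∷ xs) refl | true = fx
... | false = firstWith-satisfies f xs eq

firstWith-∈ : ∀ {A : Set} (f : A → Bool) xs {y} → firstWith f xs ≡ just y → y ∈ xs
firstWith-∈ f (x ∷ xs) eq with f x
firstWith-∈ f (x ∷ xs) refl | true = here refl
... | false = there (firstWith-∈ f xs eq)

firstWith-cong : ∀ {A : Set} {f g : A → Bool} → (∀ x → f x ≡ g x) → ∀ xs →
                 firstWith f xs ≡ firstWith g xs
firstWith-cong f≗g []       = refl
firstWith-cong {g = g} f≗g (x ∷ xs) rewrite f≗g x with g x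
... | true  = refl
... | false = firstWith-cong f≗g xs

all-∈ : ∀ {A : Set} (f : A → Bool) {xs} → all f xs ≡ true → ∀ {x} → x ∈ xs → f x ≡ true
all-∈ f {xs} all≡true x∈xs =
  Equivalence.to T-≡ (All.lookup (all⁺ f xs (Equivalence.from T-≡ all≡true)) x∈xs)

foldl-preserves : ∀ {A B : Set} (P : B → Set) (f : B → A → B) →
                  (∀ b x → P b → P (f b x)) → ∀ {b} xs → P b → P (foldl f b xs)
foldl-preserves P f pres []       Pb = Pb
foldl-preserves P f pres (x ∷ xs) Pb = foldl-preserves P f pres xs (pres _ x Pb)

indicator : Bool → ℕ
indicator true  = 1
indicator false = 0

indicator-≤ : ∀ {b c} → (b ≡ true → c ≡ true) → indicator b ≤ indicator c
indicator-≤ {false} b⇒c = z≤n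
indicator-≤ {true}  b⇒c rewrite b⇒c refl = ≤-refl

indicator-< : ∀ b c → (b ≡ true → c ≡ true) → ⌊ c B.≟ b ⌋ ≡ false → indicator b < indicator c
indicator-< false true  b⇒c c≢b = s≤s z≤n
indicator-< false false b⇒c ()
indicator-< true  c     b⇒c c≢b rewrite b⇒c refl with c≢b
... | ()

indicator≤1 : ∀ b → indicator b ≤ 1
indicator≤1 true  = ≤-refl
indicator≤1 false = z≤n

module _ {A : Set} where

  sum-map-≤ : {f g : A → ℕ} → (∀ x → f x ≤ g x) → ∀ xs → sum (map f xs) ≤ sum (map g xs)
  sum-map-≤ f≤g []       = z≤n
  sum-map-≤ f≤g (x ∷ xs) = +-mono-≤ (f≤g x) (sum-map-≤ f≤g xs)

  sum-map-< : {f g : A → ℕ} (t : A → Bool) → (∀ x → f x ≤ g x) → (∀ x → t x ≡ false → f x < g x) →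
              ∀ xs → all t xs ≡ false → sum (map f xs) < sum (map g xs)
  sum-map-< t f≤g f<g (x ∷ xs) ¬all with t x in tx
  ... | false = +-mono-<-≤ (f<g x tx) (sum-map-≤ f≤g xs)
  ... | true  = +-mono-≤-< (f≤g x) (sum-map-< t f≤g f<g xs ¬all)

  sum-map-≤-* : {f : A → ℕ} {k : ℕ} → (∀ x → f x ≤ k) → ∀ xs → sum (map f xs) ≤ length xs * k
  sum-map-≤-* f≤k []       = z≤n
  sum-map-≤-* f≤k (x ∷ xs) = +-mono-≤ (f≤k x) (sum-map-≤-* f≤k xs)

length-allFin : ∀ k → length (allFin k) ≡ k
length-allFin k = length-tabulate {n = k} (λ i → i)

module _ (I : Instance) where
  open Instance I
  open Algorithm I

  infix 4 _⊆_ _≈_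

  _⊆_ : Graph → Graph → Set
  G ⊆ H = ∀ a p → G a p ≡ true → H a p ≡ true

  _≈_ : Graph → Graph → Set
  G ≈ H = ∀ a p → G a p ≡ H a p

  ⊆-antisym : ∀ {G H} → G ⊆ H → H ⊆ G → G ≈ H
  ⊆-antisym G⊆H H⊆G a p = ⇔→≡ {z = true} (mk⇔ (G⊆H a p) (H⊆G a p))

  top-cong : ∀ {G H} → G ≈ H → ∀ a → top G a ≡ top H a
  top-cong G≈H a = firstWith-cong (G≈H a) (prefA a)

  dominated : Fin n → Fin m → Fin n → Fin m → Bool
  dominated ai p a p' = beforeᵇ (prefA ai) p' p ∧ beforeᵇ (prefP p') ai a

  processAgent-top : ∀ {G ai p} → top G ai ≡ just p → ∀ a p' →
                     processAgent G ai a p' ≡ (G a p' ∧ not (dominated ai p a p'))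
  processAgent-top {G} {ai} top≡p a p' with top G ai
  processAgent-top refl a p' | just _ = refl

  processAgent-⊆ : ∀ G ai → processAgent G ai ⊆ G
  processAgent-⊆ G ai a p e with top G ai
  ... | nothing = e
  ... | just _  = ∧-conicalˡ _ _ e

  foldl-processAgent-⊆ : ∀ {G} xs → foldl processAgent G xs ⊆ G
  foldl-processAgent-⊆ {G} xs =
    foldl-preserves (_⊆ G) processAgent
      (λ K ai K⊆G a p e → K⊆G a p (processAgent-⊆ K ai a p e)) xs (λ a p e → e)

  Irreducible : Graph → Set
  Irreducible G = ∀ {ai p a p'} → top G ai ≡ just p → G a p' ≡ true → dominated ai p a p' ≡ false

  Irreducible-cong : ∀ {G H} → G ≈ H → Irreducible G → Irreducible H
  Irreducible-cong G≈H irr {ai} {a = a} {p'} top≡p e =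
    irr (trans (top-cong G≈H ai) top≡p) (trans (G≈H a p') e)

  round-fixed⇒irreducible : ∀ {G} → G ⊆ round G → Irreducible G
  round-fixed⇒irreducible {G} G⊆round = survives (allFin n) G⊆round (λ a p e → e) (∈-allFin _)
    where
    -- Every intermediate graph K of the round is squeezed between G and round G ⊆ G.
    survives : ∀ xs {K} → G ⊆ foldl processAgent K xs → K ⊆ G → ∀ {ai p a p'} → ai ∈ xs →
               top G ai ≡ just p → G a p' ≡ true → dominated ai p a p' ≡ false
    survives (ai ∷ xs) {K} G⊆fold K⊆G {p = p} {a} {p'} (here refl) top≡p e =
      not-injective (∧-conicalʳ (K a p') _ (trans (sym (processAgent-top topK≡p a p')) (G⊆K′ a p' e)))
      where
      G⊆K′ : G ⊆ processAgent K ai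
      G⊆K′ a p e = foldl-processAgent-⊆ xs a p (G⊆fold a p e)
      topK≡p : top K ai ≡ just p
      topK≡p = trans (top-cong (⊆-antisym K⊆G (λ a p e → processAgent-⊆ K ai a p (G⊆K′ a p e))) ai) top≡p
    survives (x ∷ xs) {K} G⊆fold K⊆G (there ai∈xs) =
      survives xs G⊆fold (λ a p e → K⊆G a p (processAgent-⊆ K x a p e)) ai∈xs

  edges : Graph → ℕ
  edges H = sum (map (λ a → sum (map (λ p → indicator (H a p)) (allFin m))) (allFin n))

  edges-< : ∀ {H H'} → H' ⊆ H → sameGraph H H' ≡ false → edges H' < edges H
  edges-< {H} {H'} H'⊆H changed =
    sum-map-< _ (λ a → sum-map-≤ (λ p → indicator-≤ (H'⊆H a p)) (allFin m))
      (λ a changedₐ → sum-map-< _ (λ p → indicator-≤ (H'⊆H a p))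
                         (λ p → indicator-< (H' a p) (H a p) (H'⊆H a p)) (allFin m) changedₐ)
      (allFin n) changed

  edges-≤ : ∀ H → edges H ≤ n * m
  edges-≤ H = begin
    edges H
      ≤⟨ sum-map-≤-* (λ a → sum-map-≤-* (λ p → indicator≤1 (H a p)) (allFin m)) (allFin n) ⟩
    length (allFin n) * (length (allFin m) * 1)
      ≡⟨ cong₂ _*_ (length-allFin n) (trans (*-identityʳ _) (length-allFin m)) ⟩
    n * m
      ∎
    where open ≤-Reasoning

  sameGraph-sound : ∀ {H H'} → sameGraph H H' ≡ true → H ≈ H'
  sameGraph-sound {H} {H'} same a p with H a p | H' a p
    | all-∈ (λ p → ⌊ H a p B.≟ H' a p ⌋) (all-∈ _ same (∈-allFin a)) (∈-allFin p)
  ... | true  | true  | _ = refl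
  ... | false | false | _ = refl

  loop-irreducible : ∀ f H → edges H < f → nonIsolated (loop f H) ≡ true → Irreducible (loop f H)
  loop-irreducible (suc f) H edges<f noneIsolated with nonIsolated H in nonIsolatedH
  ... | false with () ← trans (sym nonIsolatedH) noneIsolated
  ... | true with sameGraph H (round H) in same
  ...   | true  = Irreducible-cong H≈round (round-fixed⇒irreducible (λ a p e → trans (sym (H≈round a p)) e))
    where
    H≈round : H ≈ round H
    H≈round = sameGraph-sound same
  ...   | false = loop-irreducible f (round H)
                    (<-≤-trans (edges-< (foldl-processAgent-⊆ (allFin n)) same) (≤-pred edges<f)) noneIsolated

  reduced-irreducible : ∀ t → nonIsolated (reduced t) ≡ true → Irreducible (reduced t)
  reduced-irreducible t = loop-irreducible (suc (n * m)) (initial t) (s≤s (edges-≤ (initial t)))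

  Candidate : Assignment I → Set
  Candidate M = ∃ λ t → nonIsolated (reduced t) ≡ true × M ≡ top (reduced t)

  CandidateOrNone : Maybe (Assignment I × ℕ) → Set
  CandidateOrNone nothing        = ⊤
  CandidateOrNone (just (M , _)) = Candidate M

  step-Candidate : ∀ best t → CandidateOrNone best → CandidateOrNone (step best t)
  step-Candidate best t cand with nonIsolated (reduced t) in noneIsolated
  ... | false = cand
  ... | true with best
  ...   | nothing = t , noneIsolated , refl
  ...   | just (_ , cb) with totalCost (top (reduced t)) ≤ᵇ cb
  ...     | true  = t , noneIsolated , refl
  ...     | false = cand

  output-Candidate : ∀ {M} → output ≡ just M → Candidate M
  output-Candidate out with foldl step nothing costTuples
    | foldl-preserves CandidateOrNone step step-Candidate costTuples tt
  output-Candidate refl | just _ | cand = cand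

  top-isMatching : ∀ G → IsMatching I (top G)
  top-isMatching G a p = firstWith-∈ (G a) (prefA a)

  top-stable : ∀ {G} → nonIsolated G ≡ true → Irreducible G → Stable I (top G)
  top-stable {G} noneIsolated irr a p (_ , _ , p>Ma , a' , Ma'≡p , a>a') with top G a in Ma
  ... | nothing with () ← trans (sym (cong isJust Ma)) (all-∈ (λ a → isJust (top G a)) noneIsolated (∈-allFin a))
  ... | just q with () ← trans (sym (irr Ma (firstWith-satisfies (G a') (prefA a') Ma'≡p)))
                             (cong₂ _∧_ (Ranks⇒beforeᵇ (uniqueA a) p>Ma) (Ranks⇒beforeᵇ (uniqueP p) a>a'))

lemma2 : (I : Instance) (M : Assignment I) →
    Algorithm.output I ≡ just M → IsMatching I M × Stable I M
lemma2 I M out with output-Candidate I out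
... | t , noneIsolated , refl =
  top-isMatching I (Algorithm.reduced I t) , top-stable I noneIsolated (reduced-irreducible I t noneIsolated)
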